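{- Let $n$ be a positive integer, $g_1,g_2\in\mathbb{Z}$, and $k_1\ge k_2\ge 3$ integers such that $\{\mathrm{AP}_n(g_1,k_1),\mathrm{AP}_n(g_2,k_2)\}$ is an Erdős-deep family in $\mathbb{Z}_n$ with distance multiplicities $1,2,\dots,k-1$. Put $t:=k-k_1$ and $\beta:=n/k_1$. If $n\ge (k_2-t)^2/4$, then $t\le 5\beta-\frac{3}{4}$.
   Context: For $x\in\mathbb{Z}_n$, $|x|_n:=\min(x,-x)$ with $\pm x$ reduced into $\{0,\dots,n-1\}$, and $\mathrm{dist}(x,y)=|x-y|_n$. For $A\subseteq\mathbb{Z}_n$, $\Delta A$ is the multiset of $\mathrm{dist}(x,y)$ over unordered pairs $\{x,y\}\subseteq A$ with $x\neq y$; for a family $\mathcal{F}$, $\Delta\mathcal{F}$ is the multiset union of $\Delta A$ over $A\in\mathcal{F}$. $\mathcal{F}$ is Erdős-deep if the multiplicities of the distinct values in $\Delta\mathcal{F}$ are exactly $1,2,\dots,k-1$ for some integer $k$. $\mathrm{AP}_n(g,k):=\{0,g,\dots,(k-1)g\}\subseteq\mathbb{Z}_n$, with its $k$ terms distinct. -}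

module Defs where

open import Data.Nat using (ℕ; zero; suc; NonZero; _≤?_; _⊓_)
open import Data.Nat.Properties using (_≟_)
open import Data.Integer using (ℤ; +_; _-_; _*_)
open import Data.Integer.DivMod using (_%ℕ_)
open import Data.List using (List; []; _∷_; map; upTo; filter; length; _++_)
open import Data.List.Relation.Binary.Permutation.Propositional using (_↭_)

red : (n : ℕ) .{{_ : NonZero n}} → ℤ → ℕ
red n x = x %ℕ n

absN : (n : ℕ) .{{_ : NonZero n}} → ℤ → ℕ
absN n x = red n x ⊓ red n (Data.Integer.-_ x)

-- dist(x,y) = |x - y|_n  (elements of ℤ_n represented by naturals < n)
dist : (n : ℕ) .{{_ : NonZero n}} → ℕ → ℕ → ℕ
dist n x y = absN n (+ x - + y)

AP : (n : ℕ) .{{_ : NonZero n}} → ℤ → ℕ → List ℕ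
AP n g k = map (λ i → red n (+ i * g)) (upTo k)

-- ΔA for a list of (pairwise distinct) elements: dist over all pairs of
-- positions i < j, i.e. over unordered pairs {x,y} with x ≠ y.
Δ : (n : ℕ) .{{_ : NonZero n}} → List ℕ → List ℕ
Δ n []       = []
Δ n (x ∷ xs) = map (dist n x) xs ++ Δ n xs

ΔFam : (n : ℕ) .{{_ : NonZero n}} → List (List ℕ) → List ℕ
ΔFam n []       = []
ΔFam n (A ∷ As) = Δ n A ++ ΔFam n As

count : ℕ → List ℕ → ℕ
count d xs = length (filter (d ≟_) xs)

-- multiplicities of the distinct values occurring in L, where all values lie in {0,…,n}
multiplicities : ℕ → List ℕ → List ℕ
multiplicities n L = filter (1 ≤?_) (map (λ d → count d L) (upTo (suc n)))

ErdosDeep : (n : ℕ) .{{_ : NonZero n}} → List (List ℕ) → ℕ → Set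
ErdosDeep n F k = multiplicities n (ΔFam n F) ↭ map suc (upTo (k Data.Nat.∸ 1))

{-# OPTIONS --safe #-}
-- Counting pairs: a family with distance multiplicities 1, …, k − 1 has k (k − 1) / 2 distances,
-- while the two progressions contribute k₁ (k₁ − 1) / 2 + k₂ (k₂ − 1) / 2 of them. Writing
-- k = k₁ + t and k₂ = t + u, this identity becomes u (u + 2t − 1) = 2 k₁ t with t ≥ 1. Since
-- k₁ ≥ k₂ it gives u² − u ≥ 2t², which forces 3u ≥ 4t + 3 unless (t, u) = (1, 2); then multiplying
-- 4 k₁ t + 3 k₁ by 2t and substituting 2 k₁ t yields 4 k₁ t + 3 k₁ ≤ 5u² ≤ 20n. In the exceptional
-- case k₁ = 3, and 21 ≤ 20n holds because AP_n(g₁, k₁) has distinct terms, so n ≥ 2.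
module Submission where

open import Defs
open import Data.Nat using (ℕ; NonZero; _≥_)
open import Data.List using (List; []; _∷_)
open import Data.List.Relation.Unary.Unique.Propositional using (Unique)
import Data.Nat as ℕ
import Data.Nat.Properties as ℕ

module _ where
  open import Data.Nat
  open import Data.Nat.Properties
  open import Data.Nat.ListAction using (sum)
  open import Data.Nat.ListAction.Properties using (sum-++; sum-↭)
  open import Data.Nat.Tactic.RingSolver using (solve-∀)
  open import Data.List using (map; upTo; applyUpTo; filter; length; _++_; [_])
  open import Data.List.Properties
    using (filter-accept; filter-reject; length-++; length-map; applyUpTo-∷ʳ; map-upTo)
  open import Data.List.Relation.Unary.All as All using (All; []; _∷_; universal)
  open import Data.List.Relation.Unary.All.Properties using (++⁺; map⁺)
  import Data.Integer as ℤ
  open import Data.Integer.DivMod using (n%ℕd<d)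
  open import Data.Sum using (inj₁; inj₂)
  open import Function using (_∘_)
  open import Relation.Binary.PropositionalEquality hiding ([_])
  open ≡-Reasoning

  count-≡ : ∀ {d x} L → d ≡ x → count d (x ∷ L) ≡ suc (count d L)
  count-≡ L d≡x = cong length (filter-accept (_ ≟_) d≡x)

  count-≢ : ∀ {d x} L → d ≢ x → count d (x ∷ L) ≡ count d L
  count-≢ L d≢x = cong length (filter-reject (_ ≟_) d≢x)

  sum-applyUpTo-suc : ∀ (f : ℕ → ℕ) m → sum (applyUpTo f (suc m)) ≡ sum (applyUpTo f m) + f m
  sum-applyUpTo-suc f m = begin
    sum (applyUpTo f (suc m))        ≡⟨ cong sum (applyUpTo-∷ʳ f m) ⟨
    sum (applyUpTo f m ++ [ f m ])   ≡⟨ sum-++ (applyUpTo f m) [ f m ] ⟩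
    sum (applyUpTo f m) + (f m + 0)  ≡⟨ cong (sum (applyUpTo f m) +_) (+-identityʳ (f m)) ⟩
    sum (applyUpTo f m) + f m        ∎

  square-step : ∀ s m → 2 * s + m ≡ m * m → 2 * (s + m) + suc m ≡ suc m * suc m
  square-step s m eq = begin
    2 * (s + m) + suc m        ≡⟨ regroup s m ⟩
    (2 * s + m) + (2 * m + 1)  ≡⟨ cong (_+ (2 * m + 1)) eq ⟩
    m * m + (2 * m + 1)        ≡⟨ square-suc m ⟩
    suc m * suc m              ∎
    where
    regroup : ∀ s m → 2 * (s + m) + suc m ≡ (2 * s + m) + (2 * m + 1)
    regroup = solve-∀
    square-suc : ∀ m → m * m + (2 * m + 1) ≡ suc m * suc m
    square-suc = solve-∀

  sum-upTo : ∀ n → 2 * sum (upTo n) + n ≡ n * n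
  sum-upTo zero = refl
  sum-upTo (suc m) = begin
    2 * sum (upTo (suc m)) + suc m  ≡⟨ cong (λ s → 2 * s + suc m) (sum-applyUpTo-suc (λ i → i) m) ⟩
    2 * (sum (upTo m) + m) + suc m  ≡⟨ square-step (sum (upTo m)) m (sum-upTo m) ⟩
    suc m * suc m                   ∎

  countBelow : ℕ → List ℕ → ℕ
  countBelow N L = sum (applyUpTo (λ d → count d L) N)

  countBelow-[] : ∀ N → countBelow N [] ≡ 0
  countBelow-[] zero = refl
  countBelow-[] (suc N) = trans (sum-applyUpTo-suc _ N) (trans (+-identityʳ _) (countBelow-[] N))

  countBelow-∷-≥ : ∀ {N x} L → N ≤ x → countBelow N (x ∷ L) ≡ countBelow N L
  countBelow-∷-≥ {zero} L _ = refl
  countBelow-∷-≥ {suc N} {x} L N<x = begin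
    countBelow (suc N) (x ∷ L)              ≡⟨ sum-applyUpTo-suc _ N ⟩
    countBelow N (x ∷ L) + count N (x ∷ L)  ≡⟨ cong₂ _+_ (countBelow-∷-≥ L (<⇒≤ N<x)) (count-≢ L (<⇒≢ N<x)) ⟩
    countBelow N L + count N L              ≡⟨ sum-applyUpTo-suc _ N ⟨
    countBelow (suc N) L                    ∎

  countBelow-∷-< : ∀ {N x} L → x < N → countBelow N (x ∷ L) ≡ suc (countBelow N L)
  countBelow-∷-< {suc N} {x} L x<1+N with m≤n⇒m<n∨m≡n (s≤s⁻¹ x<1+N)
  ... | inj₁ x<N = begin
    countBelow (suc N) (x ∷ L)              ≡⟨ sum-applyUpTo-suc _ N ⟩
    countBelow N (x ∷ L) + count N (x ∷ L)  ≡⟨ cong₂ _+_ (countBelow-∷-< L x<N) (count-≢ L (>⇒≢ x<N)) ⟩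
    suc (countBelow N L + count N L)        ≡⟨ cong suc (sum-applyUpTo-suc _ N) ⟨
    suc (countBelow (suc N) L)              ∎
  ... | inj₂ refl = begin
    countBelow (suc x) (x ∷ L)              ≡⟨ sum-applyUpTo-suc _ x ⟩
    countBelow x (x ∷ L) + count x (x ∷ L)  ≡⟨ cong₂ _+_ (countBelow-∷-≥ {x} L ≤-refl) (count-≡ L refl) ⟩
    countBelow x L + suc (count x L)        ≡⟨ +-suc _ _ ⟩
    suc (countBelow x L + count x L)        ≡⟨ cong suc (sum-applyUpTo-suc _ x) ⟨
    suc (countBelow (suc x) L)              ∎

  countBelow-length : ∀ {N} L → All (_< N) L → countBelow N L ≡ length L
  countBelow-length {N} [] [] = countBelow-[] N
  countBelow-length (x ∷ L) (x<N ∷ L<N) = trans (countBelow-∷-< L x<N) (cong suc (countBelow-length L L<N))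

  sum-filter-positive : ∀ xs → sum (filter (1 ≤?_) xs) ≡ sum xs
  sum-filter-positive [] = refl
  sum-filter-positive (zero ∷ xs) = sum-filter-positive xs
  sum-filter-positive (suc x ∷ xs) = cong (suc x +_) (sum-filter-positive xs)

  sum-multiplicities : ∀ n L → All (_≤ n) L → sum (multiplicities n L) ≡ length L
  sum-multiplicities n L L≤n = begin
    sum (multiplicities n L)                    ≡⟨ sum-filter-positive (map (λ d → count d L) (upTo (suc n))) ⟩
    sum (map (λ d → count d L) (upTo (suc n)))  ≡⟨ cong sum (map-upTo _ (suc n)) ⟩
    countBelow (suc n) L                        ≡⟨ countBelow-length L (All.map (λ x≤n → s≤s x≤n) L≤n) ⟩
    length L                                    ∎

  -- k (k − 1) = a (a − 1) + b (b − 1), with the subtractions moved across.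
  PairCountIdentity : ℕ → ℕ → ℕ → Set
  PairCountIdentity a b k = k * k + a + b ≡ a * a + b * b + k

  module _ {n : ℕ} .{{_ : NonZero n}} where

    dist≤n : ∀ x y → dist n x y ≤ n
    dist≤n x y = ≤-trans (m⊓n≤m _ _) (<⇒≤ (n%ℕd<d (ℤ.+ x ℤ.- ℤ.+ y) n))

    Δ-bounded : ∀ xs → All (_≤ n) (Δ n xs)
    Δ-bounded [] = []
    Δ-bounded (x ∷ xs) = ++⁺ (map⁺ (universal (dist≤n x) xs)) (Δ-bounded xs)

    ΔFam-bounded : ∀ F → All (_≤ n) (ΔFam n F)
    ΔFam-bounded [] = []
    ΔFam-bounded (A ∷ F) = ++⁺ (Δ-bounded A) (ΔFam-bounded F)

    length-Δ : ∀ xs → 2 * length (Δ n xs) + length xs ≡ length xs * length xs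
    length-Δ [] = refl
    length-Δ (x ∷ xs) = begin
      2 * length (map (dist n x) xs ++ Δ n xs) + suc l  ≡⟨ cong (λ d → 2 * d + suc l) length-head ⟩
      2 * (length (Δ n xs) + l) + suc l                ≡⟨ square-step (length (Δ n xs)) l (length-Δ xs) ⟩
      suc l * suc l                                    ∎
      where
      l = length xs
      length-head : length (map (dist n x) xs ++ Δ n xs) ≡ length (Δ n xs) + l
      length-head = begin
        length (map (dist n x) xs ++ Δ n xs)          ≡⟨ length-++ (map (dist n x) xs) ⟩
        length (map (dist n x) xs) + length (Δ n xs)  ≡⟨ cong (_+ length (Δ n xs)) (length-map (dist n x) xs) ⟩
        l + length (Δ n xs)                           ≡⟨ +-comm l (length (Δ n xs)) ⟩
        length (Δ n xs) + l                           ∎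

    length-ΔFam : ∀ F → length (ΔFam n F) ≡ sum (map (length ∘ Δ n) F)
    length-ΔFam [] = refl
    length-ΔFam (A ∷ F) = trans (length-++ (Δ n A)) (cong (length (Δ n A) +_) (length-ΔFam F))

    ErdosDeep⇒length-ΔFam : ∀ F k → ErdosDeep n F k → 2 * length (ΔFam n F) + k ≡ k * k
    ErdosDeep⇒length-ΔFam F k deep = begin
      2 * length (ΔFam n F) + k                  ≡⟨ cong (λ s → 2 * s + k) (sum-multiplicities n _ (ΔFam-bounded F)) ⟨
      2 * sum (multiplicities n (ΔFam n F)) + k  ≡⟨ cong (λ s → 2 * s + k) (sum-↭ deep) ⟩
      2 * sum (map suc (upTo (k ∸ 1))) + k       ≡⟨ cong (λ s → 2 * s + k) (sum-upTo-pred k) ⟩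
      2 * sum (upTo k) + k                       ≡⟨ sum-upTo k ⟩
      k * k                                      ∎
      where
      sum-upTo-pred : ∀ k → sum (map suc (upTo (k ∸ 1))) ≡ sum (upTo k)
      sum-upTo-pred zero = refl
      sum-upTo-pred (suc m) = cong sum (map-upTo suc m)

    ErdosDeep⇒PairCountIdentity : ∀ A B k → ErdosDeep n (A ∷ B ∷ []) k →
                                  PairCountIdentity (length A) (length B) k
    ErdosDeep⇒PairCountIdentity A B k deep = begin
      k * k + a + b                                 ≡⟨ cong (λ s → s + a + b) (ErdosDeep⇒length-ΔFam F k deep) ⟨
      2 * length (ΔFam n F) + k + a + b             ≡⟨ cong (λ s → 2 * s + k + a + b) (length-ΔFam F) ⟩
      2 * (dA + (dB + 0)) + k + a + b               ≡⟨ regroup dA dB k a b ⟩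
      (2 * dA + a) + (2 * dB + b) + k               ≡⟨ cong₂ (λ x y → x + y + k) (length-Δ A) (length-Δ B) ⟩
      a * a + b * b + k                             ∎
      where
      F = A ∷ B ∷ []
      a = length A
      b = length B
      dA = length (Δ n A)
      dB = length (Δ n B)
      regroup : ∀ dA dB k a b → 2 * (dA + (dB + 0)) + k + a + b ≡ (2 * dA + a) + (2 * dB + b) + k
      regroup = solve-∀

module _ where
  open import Data.Nat
  open import Data.Nat.Properties using (n<1⇒n≡0)
  open import Data.List using (length; upTo)
  open import Data.List.Properties using (length-map; length-upTo)
  open import Data.List.Relation.Unary.AllPairs using (_∷_)
  open import Data.List.Relation.Unary.All using (_∷_)
  import Data.Integer as ℤ
  open import Data.Integer.DivMod using (n%ℕd<d)
  open import Relation.Binary.PropositionalEquality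
  open import Relation.Nullary using (contradiction)

  length-AP : ∀ n .{{_ : NonZero n}} g k → length (AP n g k) ≡ k
  length-AP n g k = trans (length-map _ (upTo k)) (length-upTo k)

  AP-unique⇒2≤n : ∀ n .{{_ : NonZero n}} g {k} → 2 ≤ k → Unique (AP n g k) → 2 ≤ n
  AP-unique⇒2≤n (suc (suc n)) g _ _ = s≤s (s≤s z≤n)
  AP-unique⇒2≤n 1 g (s≤s (s≤s _)) ((0≢g ∷ _) ∷ _) =
    contradiction (trans (red1≡0 (ℤ.+ 0 ℤ.* g)) (sym (red1≡0 (ℤ.+ 1 ℤ.* g)))) 0≢g
    where
    red1≡0 : ∀ x → red 1 x ≡ 0
    red1≡0 x = n<1⇒n≡0 (n%ℕd<d x 1)

  AP-PairCountIdentity : ∀ n .{{_ : NonZero n}} g₁ g₂ k₁ k₂ k →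
    ErdosDeep n (AP n g₁ k₁ ∷ AP n g₂ k₂ ∷ []) k → PairCountIdentity k₁ k₂ k
  AP-PairCountIdentity n g₁ g₂ k₁ k₂ k deep =
    subst₂ (λ a b → PairCountIdentity a b k) (length-AP n g₁ k₁) (length-AP n g₂ k₂)
      (ErdosDeep⇒PairCountIdentity (AP n g₁ k₁) (AP n g₂ k₂) k deep)

module _ where
  open import Data.Nat
  open import Data.Nat.Properties
  open import Data.Nat.Tactic.RingSolver using (solve)
  open import Data.Product using (∃₂; _×_; _,_)
  open import Data.Sum using (_⊎_; inj₁; inj₂)
  open import Relation.Nullary using (yes; no; contradiction)
  open import Relation.Binary.PropositionalEquality
  open ≤-Reasoning

  n≤n*n : ∀ n → n ≤ n * n
  n≤n*n zero = z≤n
  n≤n*n n@(suc _) = m≤m*n n n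

  m*m+n≤n*n+m : ∀ {m n} → m ≤ n → m * m + n ≤ n * n + m
  m*m+n≤n*n+m {m} m≤n with m≤n⇒∃[o]m+o≡n m≤n
  ... | s , refl = begin
    m * m + (m + s)                  ≡⟨ solve (m ∷ s ∷ []) ⟩
    m * m + m + s                    ≤⟨ +-monoʳ-≤ (m * m + m) (≤-trans (n≤n*n s) (m≤n+m (s * s) (2 * m * s))) ⟩
    m * m + m + (2 * m * s + s * s)  ≡⟨ solve (m ∷ s ∷ []) ⟩
    (m + s) * (m + s) + m            ∎

  PairCountIdentity⇒a<k : ∀ {a b k} → 2 ≤ b → PairCountIdentity a b k → a < k
  PairCountIdentity⇒a<k {a} {b} {k} 2≤b eq = ≰⇒> λ k≤a → <⇒≱ b<b*b (b*b≤b k≤a)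
    where
    b<b*b : b < b * b
    b<b*b = m<m*n b b {{>-nonZero (<⇒≤ 2≤b)}} 2≤b
    b*b≤b : k ≤ a → b * b ≤ b
    b*b≤b k≤a = +-cancelˡ-≤ (a * a + k) (b * b) b (begin
      a * a + k + b * b  ≡⟨ solve (a ∷ b ∷ k ∷ []) ⟩
      a * a + b * b + k  ≡⟨ eq ⟨
      k * k + a + b      ≤⟨ +-monoˡ-≤ b (m*m+n≤n*n+m k≤a) ⟩
      a * a + k + b      ∎)

  PairCountIdentity-shift : ∀ {a b t} → PairCountIdentity a b (a + t) → 2 * a * t + t * t + b ≡ b * b + t
  PairCountIdentity-shift {a} {b} {t} eq = +-cancelˡ-≡ (a * a + a) _ _ (begin-equality
    a * a + a + (2 * a * t + t * t + b)  ≡⟨ solve (a ∷ b ∷ t ∷ []) ⟩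
    (a + t) * (a + t) + a + b            ≡⟨ eq ⟩
    a * a + b * b + (a + t)              ≡⟨ solve (a ∷ b ∷ t ∷ []) ⟩
    a * a + a + (b * b + t)              ∎)

  PairCountIdentity⇒t<b : ∀ {a b t} → 1 ≤ b → b ≤ a → PairCountIdentity a b (a + t) → t < b
  PairCountIdentity⇒t<b {a} {b} {t} 1≤b b≤a eq =
    ≰⇒> λ b≤t → <-irrefl (sym (PairCountIdentity-shift {a} {b} {t} eq)) (begin-strict
      b * b + t                  ≤⟨ +-mono-≤ (*-mono-≤ b≤a b≤t) (n≤n*n t) ⟩
      a * t + t * t              ≤⟨ +-monoˡ-≤ (t * t) (m≤m+n (a * t) (a * t)) ⟩
      a * t + a * t + t * t      <⟨ m<m+n _ 1≤b ⟩
      a * t + a * t + t * t + b  ≡⟨ solve (a ∷ b ∷ t ∷ []) ⟩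
      2 * a * t + t * t + b      ∎)

  PairCountIdentity⇒equation : ∀ {a t u} → PairCountIdentity a (t + u) (a + t) →
                               u * u + 2 * t * u ≡ 2 * a * t + u
  PairCountIdentity⇒equation {a} {t} {u} eq = +-cancelˡ-≡ (t * t + t) _ _ (begin-equality
    t * t + t + (u * u + 2 * t * u)  ≡⟨ solve (t ∷ u ∷ []) ⟩
    (t + u) * (t + u) + t            ≡⟨ PairCountIdentity-shift {a} {t + u} {t} eq ⟨
    2 * a * t + t * t + (t + u)      ≡⟨ solve (a ∷ t ∷ u ∷ []) ⟩
    t * t + t + (2 * a * t + u)      ∎)

  PairCountIdentity⇒parameters : ∀ {a b k} → b ≤ a → 2 ≤ b → PairCountIdentity a b k →
    ∃₂ λ t u → k ≡ a + t × b ≡ t + u × 1 ≤ t × u * u + 2 * t * u ≡ 2 * a * t + u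
  PairCountIdentity⇒parameters {a} {b} {k} b≤a 2≤b eq
    with m≤n⇒∃[o]m+o≡n {a} {k} (<⇒≤ (PairCountIdentity⇒a<k {a} {b} {k} 2≤b eq))
       | PairCountIdentity⇒a<k {a} {b} {k} 2≤b eq
  ... | t , refl | a<a+t with m≤n⇒∃[o]m+o≡n {t} {b} (<⇒≤ (PairCountIdentity⇒t<b {a} {b} {t} (<⇒≤ 2≤b) b≤a eq))
  ... | u , refl = t , u , refl , refl , 1≤t , PairCountIdentity⇒equation {a} {t} {u} eq
    where
    1≤t : 1 ≤ t
    1≤t = +-cancelˡ-≤ a 1 t (subst (_≤ a + t) (+-comm 1 a) a<a+t)

  2*t*t+u≤u*u : ∀ {a t u} → t + u ≤ a → u * u + 2 * t * u ≡ 2 * a * t + u → 2 * t * t + u ≤ u * u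
  2*t*t+u≤u*u {a} {t} {u} t+u≤a eq = +-cancelʳ-≤ (2 * t * u) _ _ (begin
    2 * t * t + u + 2 * t * u  ≡⟨ solve (t ∷ u ∷ []) ⟩
    2 * (t + u) * t + u        ≤⟨ +-monoˡ-≤ u (*-monoˡ-≤ t (*-monoʳ-≤ 2 t+u≤a)) ⟩
    2 * a * t + u              ≡⟨ eq ⟨
    u * u + 2 * t * u          ∎)

  -- With t = x + 2 and u = v + 1: 9 u (u − 1) ≤ (4x + 10)(4x + 7) = 18 t² − 2 (x + 1)².
  u*u<2*t*t+u : ∀ {t u} → 2 ≤ t → 3 * u < 4 * t + 3 → u * u < 2 * t * t + u
  u*u<2*t*t+u {1} (s≤s ()) _
  u*u<2*t*t+u {suc (suc x)} {zero} _ _ = s≤s z≤n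
  u*u<2*t*t+u {suc (suc x)} {suc v} _ 3u<4t+3 = *-cancelˡ-< 9 _ _ (begin-strict
    9 * (suc v * suc v)                                            ≡⟨ solve (v ∷ []) ⟩
    (3 * v + 3) * (3 * v) + 9 * suc v                              ≤⟨ +-monoˡ-≤ (9 * suc v) (*-mono-≤ (+-monoˡ-≤ 3 3v≤4x+7) 3v≤4x+7) ⟩
    (4 * x + 7 + 3) * (4 * x + 7) + 9 * suc v                      <⟨ +-monoˡ-< (9 * suc v) (m<m+n _ (s≤s z≤n)) ⟩
    (4 * x + 7 + 3) * (4 * x + 7) + 2 * suc x * suc x + 9 * suc v  ≡⟨ solve (x ∷ v ∷ []) ⟩
    9 * (2 * suc (suc x) * suc (suc x) + suc v)                    ∎)
    where
    3v≤4x+7 : 3 * v ≤ 4 * x + 7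
    3v≤4x+7 = +-cancelʳ-≤ 4 (3 * v) (4 * x + 7) (begin
      3 * v + 4            ≡⟨ solve (v ∷ []) ⟩
      suc (3 * suc v)      ≤⟨ 3u<4t+3 ⟩
      4 * suc (suc x) + 3  ≡⟨ solve (x ∷ []) ⟩
      4 * x + 7 + 4        ∎)

  4*t+3≤3*u : ∀ {t u} → 1 ≤ t → 2 * t * t + u ≤ u * u → 4 * t + 3 ≤ 3 * u ⊎ (t ≡ 1 × u ≡ 2)
  4*t+3≤3*u {1} {0} _ ()
  4*t+3≤3*u {1} {1} _ (s≤s ())
  4*t+3≤3*u {1} {2} _ _ = inj₂ (refl , refl)
  4*t+3≤3*u {1} {suc (suc (suc v))} _ _ = inj₁ (≤-trans (m≤m+n 7 2) (*-monoʳ-≤ 3 (s≤s (s≤s (s≤s z≤n)))))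
  4*t+3≤3*u {t@(suc (suc _))} {u} _ gap with 4 * t + 3 ≤? 3 * u
  ... | yes 4t+3≤3u = inj₁ 4t+3≤3u
  ... | no 4t+3≰3u = contradiction gap (<⇒≱ (u*u<2*t*t+u (s≤s (s≤s z≤n)) (≰⇒> 4t+3≰3u)))

  -- Multiply by 2t and use 2at = u (u + 2t − 1); the surplus (2t − 1)(4t + 3) ≤ (2t − 1) 3u is absorbed.
  4*a*t+3*a≤5*u*u : ∀ {a t u} → 1 ≤ t → 4 * t + 3 ≤ 3 * u → u * u + 2 * t * u ≡ 2 * a * t + u →
                    4 * a * t + 3 * a ≤ 5 * (u * u)
  4*a*t+3*a≤5*u*u {a} {t@(suc w)} {u} _ 4t+3≤3u eq =
    *-cancelˡ-≤ (2 * t) (+-cancelʳ-≤ (u * (4 * t + 3)) _ _ (begin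
      2 * t * (4 * a * t + 3 * a) + u * (4 * t + 3)  ≡⟨ solve (a ∷ w ∷ u ∷ []) ⟩
      (2 * a * t + u) * (4 * t + 3)                  ≡⟨ cong (_* (4 * t + 3)) eq ⟨
      (u * u + 2 * t * u) * (4 * t + 3)              ≡⟨ solve (w ∷ u ∷ []) ⟩
      u * ((u + 2 * t) * (4 * t + 3))                ≤⟨ *-monoʳ-≤ u surplus ⟩
      u * (10 * t * u + (4 * t + 3))                 ≡⟨ solve (w ∷ u ∷ []) ⟩
      2 * t * (5 * (u * u)) + u * (4 * t + 3)        ∎))
    where
    surplus : (u + 2 * t) * (4 * t + 3) ≤ 10 * t * u + (4 * t + 3)
    surplus = +-cancelʳ-≤ ((2 * w + 1) * (4 * t + 3)) _ _ (begin
      (u + 2 * t) * (4 * t + 3) + (2 * w + 1) * (4 * t + 3)  ≤⟨ +-monoʳ-≤ _ (*-monoʳ-≤ (2 * w + 1) 4t+3≤3u) ⟩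
      (u + 2 * t) * (4 * t + 3) + (2 * w + 1) * (3 * u)      ≡⟨ solve (w ∷ u ∷ []) ⟩
      10 * t * u + (4 * t + 3) + (2 * w + 1) * (4 * t + 3)   ∎)

  4*a*t+3*a≤20*n : ∀ {a t u n} → 2 ≤ n → 1 ≤ t → t + u ≤ a → u * u + 2 * t * u ≡ 2 * a * t + u →
                   u * u ≤ 4 * n → 4 * a * t + 3 * a ≤ 20 * n
  4*a*t+3*a≤20*n {a} {t} {u} {n} 2≤n 1≤t t+u≤a eq u*u≤4n with 4*t+3≤3*u 1≤t (2*t*t+u≤u*u t+u≤a eq)
  ... | inj₁ 4t+3≤3u = begin
    4 * a * t + 3 * a  ≤⟨ 4*a*t+3*a≤5*u*u {a} 1≤t 4t+3≤3u eq ⟩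
    5 * (u * u)        ≤⟨ *-monoʳ-≤ 5 u*u≤4n ⟩
    5 * (4 * n)        ≡⟨ *-assoc 5 4 n ⟨
    20 * n             ∎
  ... | inj₂ (refl , refl) =
    subst (λ a → 4 * a * 1 + 3 * a ≤ 20 * n) (sym a≡3) (≤-trans (m≤m+n 21 19) (*-monoʳ-≤ 20 2≤n))
    where
    a≡3 : a ≡ 3
    a≡3 = *-cancelˡ-≡ a 3 2 (+-cancelʳ-≡ 2 (2 * a) 6 (trans (cong (_+ 2) (sym (*-identityʳ (2 * a)))) (sym eq)))

open import Data.Integer using (ℤ; +_; _-_; _*_; _≤_)

module _ where
  open import Data.Nat.Properties using (m+n∸m≡n; m≤m+n; m+n≤o⇒m≤o∸n; m+n≤o⇒n≤o)
  open import Data.Integer using (+≤+)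
  open import Data.Integer.Properties using ([+m]-[+n]≡m⊖n; ≤-⊖)
  open import Relation.Binary.PropositionalEquality

  +m-+n≡+[m∸n] : ∀ {m n} → n ℕ.≤ m → + m - + n ≡ + (m ℕ.∸ n)
  +m-+n≡+[m∸n] {m} {n} n≤m = trans ([+m]-[+n]≡m⊖n m n) (≤-⊖ n≤m)

  +[m+n]-+m≡+n : ∀ m n → + (m ℕ.+ n) - + m ≡ + n
  +[m+n]-+m≡+n m n = trans (+m-+n≡+[m∸n] (m≤m+n m n)) (cong +_ (m+n∸m≡n m n))

  m+n≤o⇒+m≤+o-+n : ∀ {m n o} → m ℕ.+ n ℕ.≤ o → + m ≤ + o - + n
  m+n≤o⇒+m≤+o-+n {m} m+n≤o =
    subst (+ m ≤_) (sym (+m-+n≡+[m∸n] (m+n≤o⇒n≤o m m+n≤o))) (+≤+ (m+n≤o⇒m≤o∸n m m+n≤o))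

open import Data.Integer.Properties using (pos-*; drop‿+≤+)
open import Data.Product using (_,_)
open import Relation.Binary.PropositionalEquality using (refl; sym; subst; subst₂)

proposition3p7 : (n : ℕ) .{{_ : NonZero n}} (g₁ g₂ : ℤ) (k₁ k₂ k : ℕ) →
    k₁ ≥ k₂ → k₂ ≥ 3 →
    Unique (AP n g₁ k₁) → Unique (AP n g₂ k₂) →
    ErdosDeep n (AP n g₁ k₁ ∷ AP n g₂ k₂ ∷ []) k →
    let t = + k - + k₁ in
    (+ k₂ - t) * (+ k₂ - t) ≤ + 4 * + n →
    + 4 * + k₁ * t ≤ + 20 * + n - + 3 * + k₁
proposition3p7 n g₁ g₂ k₁ k₂ k k₁≥k₂ k₂≥3 unique₁ _ deep bound
  with PairCountIdentity⇒parameters k₁≥k₂ (ℕ.<⇒≤ k₂≥3) (AP-PairCountIdentity n g₁ g₂ k₁ k₂ k deep)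
... | t , u , refl , refl , 1≤t , eq rewrite +[m+n]-+m≡+n k₁ t = ℤ-bound
  where
  2≤n : 2 ℕ.≤ n
  2≤n = AP-unique⇒2≤n n g₁ (ℕ.≤-trans (ℕ.<⇒≤ k₂≥3) k₁≥k₂) unique₁
  u*u≤4n : u ℕ.* u ℕ.≤ 4 ℕ.* n
  u*u≤4n = drop‿+≤+ (subst₂ _≤_ (sym (pos-* u u)) (sym (pos-* 4 n))
             (subst (λ d → d * d ≤ + 4 * + n) (+[m+n]-+m≡+n t u) bound))
  ℤ-bound : + 4 * + k₁ * + t ≤ + 20 * + n - + 3 * + k₁
  ℤ-bound rewrite sym (pos-* 4 k₁) | sym (pos-* (4 ℕ.* k₁) t) | sym (pos-* 20 n) | sym (pos-* 3 k₁) =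
    m+n≤o⇒+m≤+o-+n (4*a*t+3*a≤20*n 2≤n 1≤t k₁≥k₂ eq u*u≤4n)
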